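{- Let $\pi$ be a Baxter permutation of $\{1,\dots,n\}$, stored in an array $A[1..n]$ with $A[i]=\pi(i)$. Then $\pi$ can be recovered from the answers to all range minimum queries and all range maximum queries on $A$ (i.e., from the map $[i,j]\mapsto(\arg\min_{\ell\in[i,j]}A[\ell],\arg\max_{\ell\in[i,j]}A[\ell])$ over all $1\le i\le j\le n$).
   Context: A permutation $\pi$ of $\{1,\dots,n\}$ is a Baxter permutation if there are no indices $1 \le i < j < k \le n$ (with $j+1<k$ implicit from $j+1 \le k$ ordering of the pattern) such that $\pi(j+1) < \pi(i) < \pi(k) < \pi(j)$ or $\pi(j) < \pi(k) < \pi(i) < \pi(j+1)$; equivalently, $\pi$ avoids the patterns $2\text{ - }41\text{ - }3$ and $3\text{ - }14\text{ - }2$, where the two middle entries of each pattern must be at consecutive positions and the other entries may be at arbitrary positions respecting the order. -}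

module Defs where

open import Data.Nat using (ℕ; suc)
open import Data.Fin using (Fin; toℕ; _<_; _≤_)
open import Data.Fin.Permutation using (Permutation′; _⟨$⟩ʳ_)
open import Data.Product using (_×_)
open import Data.Sum using (_⊎_)
open import Relation.Binary.PropositionalEquality using (_≡_)
open import Relation.Nullary using (¬_)

-- Positions and values are 0-indexed (Fin n = {0,…,n-1}); array A[ℓ] = π ⟨$⟩ʳ ℓ.

IsBaxter : ∀ {n} → Permutation′ n → Set
IsBaxter {n} π =
  (i j j' k : Fin n) → i < j → toℕ j' ≡ suc (toℕ j) → j' < k →
  ¬ ( (A j' < A i × A i < A k × A k < A j)
    ⊎ (A j < A k × A k < A i × A i < A j') )
  where
  A : Fin n → Fin n
  A = π ⟨$⟩ʳ_

IsArgMin : ∀ {n} → Permutation′ n → Fin n → Fin n → Fin n → Set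
IsArgMin {n} π i j ℓ =
  i ≤ ℓ × ℓ ≤ j × ((m : Fin n) → i ≤ m → m ≤ j → (π ⟨$⟩ʳ ℓ) ≤ (π ⟨$⟩ʳ m))

IsArgMax : ∀ {n} → Permutation′ n → Fin n → Fin n → Fin n → Set
IsArgMax {n} π i j ℓ =
  i ≤ ℓ × ℓ ≤ j × ((m : Fin n) → i ≤ m → m ≤ j → (π ⟨$⟩ʳ m) ≤ (π ⟨$⟩ʳ ℓ))

SameRMQAnswers : ∀ {n} → Permutation′ n → Permutation′ n → Set
SameRMQAnswers {n} π σ =
  (i j ℓ : Fin n) → i ≤ j →
    (IsArgMin π i j ℓ → IsArgMin σ i j ℓ) × (IsArgMin σ i j ℓ → IsArgMin π i j ℓ)
  × (IsArgMax π i j ℓ → IsArgMax σ i j ℓ) × (IsArgMax σ i j ℓ → IsArgMax π i j ℓ)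

-- Suppose i < j is an ascent of π (π i < π j) that is an inversion of σ, with j − i minimal.
-- Every position strictly between i and j then lies below π i or above π j: a value in
-- between would split the pair into two shorter ascents of π, hence of σ.  If no position
-- lies below, i is the range minimum of π on [i, j], hence of σ, contradicting σ j < σ i;
-- symmetrically some position lies above.  Where the positions below and above meet, two
-- adjacent positions p, p + 1 form, together with i and j, a 2-41-3 pattern in π or a
-- 3-14-2 pattern in σ.  So π and σ have the same ascents, and permutations with the same
-- relative order coincide.
module Submission where

open import Defs
open import Data.Nat using (ℕ)
open import Data.Fin using (Fin)
open import Data.Fin.Permutation using (Permutation′; _⟨$⟩ʳ_)
open import Relation.Binary.PropositionalEquality using (_≡_)

open import Data.Nat as ℕ using (zero; suc; z≤n; s≤s⁻¹)
import Data.Nat.Properties as ℕ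
open import Data.Fin using (toℕ; fromℕ<; inject₁; _<_; _≤_) renaming (suc to fsuc)
open import Data.Fin.Properties
  using (toℕ-injective; toℕ-fromℕ<; toℕ<n; toℕ-inject₁; ≤̄⇒inject₁<; <-cmp; <-asym; <-trans;
         <-irrefl; ≤-refl; ≤-antisym; _<?_; any?; all?)
open import Data.Fin.Induction using (<-weakInduction)
open import Data.Fin.Permutation using (_⟨$⟩ˡ_; inverseˡ; inverseʳ)
open import Function.Bundles using (Injection)
open import Function.Properties.Inverse using (↔⇒↣)
open import Data.Product using (_×_; _,_; ∃; ∃₂; ∃-syntax; proj₁; proj₂)
open import Data.Sum using (_⊎_; inj₁; inj₂)
open import Data.Empty using (⊥; ⊥-elim)
open import Relation.Nullary using (¬_; yes; no; contradiction)
open import Relation.Nullary.Decidable using (_×-dec_; _→-dec_)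
open import Relation.Unary using (Decidable)
open import Relation.Binary using (tri<; tri≈; tri>)
open import Relation.Binary.PropositionalEquality using (refl; sym; trans; cong; subst; subst₂)

crossing : {Q : ℕ → Set} → Decidable Q → ∀ {a b} → a ℕ.< b → Q a → ¬ Q b →
           ∃[ p ] a ℕ.≤ p × p ℕ.< b × Q p × ¬ Q (suc p)
crossing {Q} Q? {a} {suc b} a<1+b Qa ¬Q1+b with Q? b
... | yes Qb = b , s≤s⁻¹ a<1+b , ℕ.n<1+n b , Qb , ¬Q1+b
... | no ¬Qb with crossing Q? (ℕ.≤∧≢⇒< (s≤s⁻¹ a<1+b) λ { refl → ¬Qb Qa }) Qa ¬Qb
...   | p , a≤p , p<b , Qp , ¬Q1+p = p , a≤p , ℕ.m<n⇒m<1+n p<b , Qp , ¬Q1+p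

fin-crossing : ∀ {n} {L : Fin n → Set} → Decidable L → ∀ {a b} → a < b → L a → ¬ L b →
               ∃₂ λ p p′ → toℕ p′ ≡ suc (toℕ p) × a ≤ p × p′ ≤ b × L p × ¬ L p′
fin-crossing {n} {L} L? {a} {b} a<b La ¬Lb
  with crossing Q? a<b (λ k k≡a → subst L (sym (toℕ-injective k≡a)) La) (λ Qb → ¬Lb (Qb b refl))
  where
  Q : ℕ → Set
  Q x = ∀ k → toℕ k ≡ x → L k
  Q? : Decidable Q
  Q? x = all? λ k → (toℕ k ℕ.≟ x) →-dec L? k
... | p , a≤p , p<b , Qp , ¬Q1+p =
  fromℕ< p<n , fromℕ< 1+p<n ,
  trans (toℕ-fromℕ< 1+p<n) (cong suc (sym (toℕ-fromℕ< p<n))) ,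
  subst (toℕ a ℕ.≤_) (sym (toℕ-fromℕ< p<n)) a≤p ,
  subst (ℕ._≤ toℕ b) (sym (toℕ-fromℕ< 1+p<n)) p<b ,
  Qp (fromℕ< p<n) (toℕ-fromℕ< p<n) ,
  λ Lp′ → ¬Q1+p λ k k≡1+p → subst L (toℕ-injective (trans (toℕ-fromℕ< 1+p<n) (sym k≡1+p))) Lp′
  where
  1+p<n : suc p ℕ.< n
  1+p<n = ℕ.≤-<-trans p<b (toℕ<n b)
  p<n : p ℕ.< n
  p<n = ℕ.<-trans (ℕ.n<1+n p) 1+p<n

strictMono⇒inflationary : ∀ {n} (f : Fin n → Fin n) → (∀ {v w} → v < w → f v < f w) →
                          ∀ x → x ≤ f x
strictMono⇒inflationary {suc n} f f-mono = <-weakInduction (λ x → x ≤ f x) z≤n step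
  where
  step : ∀ i → inject₁ i ≤ f (inject₁ i) → fsuc i ≤ f (fsuc i)
  step i i≤fi = subst (ℕ._< toℕ (f (fsuc i))) (toℕ-inject₁ i)
                      (ℕ.≤-<-trans i≤fi (f-mono (≤̄⇒inject₁< ≤-refl)))

⟨$⟩ʳ-injective : ∀ {n} (π : Permutation′ n) {i j} → π ⟨$⟩ʳ i ≡ π ⟨$⟩ʳ j → i ≡ j
⟨$⟩ʳ-injective π = Injection.injective (↔⇒↣ π)

SameOrder : ∀ {n} → Permutation′ n → Permutation′ n → Set
SameOrder π σ = ∀ {i j} → π ⟨$⟩ʳ i < π ⟨$⟩ʳ j → σ ⟨$⟩ʳ i < σ ⟨$⟩ʳ j

sameOrder⇒≤ : ∀ {n} (π σ : Permutation′ n) → SameOrder π σ → ∀ ℓ → π ⟨$⟩ʳ ℓ ≤ σ ⟨$⟩ʳ ℓ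
sameOrder⇒≤ π σ same ℓ =
  subst (λ k → π ⟨$⟩ʳ ℓ ≤ σ ⟨$⟩ʳ k) (inverseˡ π) (strictMono⇒inflationary f f-mono (π ⟨$⟩ʳ ℓ))
  where
  f : Fin _ → Fin _
  f v = σ ⟨$⟩ʳ (π ⟨$⟩ˡ v)
  f-mono : ∀ {v w} → v < w → f v < f w
  f-mono {v} {w} v<w = same (subst₂ _<_ (sym (inverseʳ π)) (sym (inverseʳ π)) v<w)

PreservesAscents : ∀ {n} → Permutation′ n → Permutation′ n → Set
PreservesAscents π σ = ∀ {i j} → i < j → π ⟨$⟩ʳ i < π ⟨$⟩ʳ j → σ ⟨$⟩ʳ i < σ ⟨$⟩ʳ j

sameAscents⇒sameOrder : ∀ {n} (π σ : Permutation′ n) →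
                        PreservesAscents π σ → PreservesAscents σ π → SameOrder π σ
sameAscents⇒sameOrder π σ π⇒σ σ⇒π {i} {j} πi<πj with <-cmp i j
... | tri< i<j _ _ = π⇒σ i<j πi<πj
... | tri≈ _ refl _ = contradiction πi<πj (<-irrefl refl)
... | tri> _ _ j<i with <-cmp (σ ⟨$⟩ʳ i) (σ ⟨$⟩ʳ j)
...   | tri< σi<σj _ _ = σi<σj
...   | tri≈ _ σi≡σj _ = contradiction (⟨$⟩ʳ-injective σ σi≡σj) (λ { refl → <-irrefl refl j<i })
...   | tri> _ _ σj<σi = contradiction (σ⇒π j<i σj<σi) (<-asym πi<πj)

sameAscents⇒≡ : ∀ {n} (π σ : Permutation′ n) →
                PreservesAscents π σ → PreservesAscents σ π → ∀ ℓ → π ⟨$⟩ʳ ℓ ≡ σ ⟨$⟩ʳ ℓ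
sameAscents⇒≡ π σ π⇒σ σ⇒π ℓ =
  ≤-antisym (sameOrder⇒≤ π σ (sameAscents⇒sameOrder π σ π⇒σ σ⇒π) ℓ)
            (sameOrder⇒≤ σ π (sameAscents⇒sameOrder σ π σ⇒π π⇒σ) ℓ)

SameRMQAnswers-sym : ∀ {n} (π σ : Permutation′ n) → SameRMQAnswers π σ → SameRMQAnswers σ π
SameRMQAnswers-sym π σ same i j ℓ i≤j with same i j ℓ i≤j
... | min⇒ , min⇐ , max⇒ , max⇐ = min⇐ , min⇒ , max⇐ , max⇒

module _ {n} (π σ : Permutation′ n) (π-baxter : IsBaxter π) (σ-baxter : IsBaxter σ)
         (same : SameRMQAnswers π σ) where

  private
    A B : Fin n → Fin n
    A = π ⟨$⟩ʳ_
    B = σ ⟨$⟩ʳ_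

  argMin-transfer : ∀ {i j ℓ} → i ≤ j → IsArgMin π i j ℓ → IsArgMin σ i j ℓ
  argMin-transfer i≤j = proj₁ (same _ _ _ i≤j)

  argMax-transfer : ∀ {i j ℓ} → i ≤ j → IsArgMax π i j ℓ → IsArgMax σ i j ℓ
  argMax-transfer i≤j = proj₁ (proj₂ (proj₂ (same _ _ _ i≤j)))

  module Inversion {i j : Fin n} (i<j : i < j) (Ai<Aj : A i < A j) (Bj<Bi : B j < B i)
    (from-i : ∀ {k} → i < k → k < j → A i < A k → B i < B k)
    (to-j : ∀ {k} → i < k → k < j → A k < A j → B k < B j) where

    Between : Fin n → Set
    Between k = i < k × k < j

    Low High : Fin n → Set
    Low k = Between k × A k < A i
    High k = Between k × A j < A k

    low-or-high : ∀ {k} → Between k → A k < A i ⊎ A j < A k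
    low-or-high {k} (i<k , k<j) with <-cmp (A k) (A i)
    ... | tri< Ak<Ai _ _ = inj₁ Ak<Ai
    ... | tri≈ _ Ak≡Ai _ = contradiction (⟨$⟩ʳ-injective π Ak≡Ai) (λ { refl → <-irrefl refl i<k })
    ... | tri> _ _ Ai<Ak with <-cmp (A k) (A j)
    ...   | tri< Ak<Aj _ _ = contradiction (<-trans (from-i i<k k<j Ai<Ak) (to-j i<k k<j Ak<Aj))
                                           (<-asym Bj<Bi)
    ...   | tri≈ _ Ak≡Aj _ = contradiction (⟨$⟩ʳ-injective π Ak≡Aj) (λ { refl → <-irrefl refl k<j })
    ...   | tri> _ _ Aj<Ak = inj₂ Aj<Ak

    range-cases : ∀ {m} → i ≤ m → m ≤ j → i ≡ m ⊎ Between m ⊎ m ≡ j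
    range-cases i≤m m≤j with ℕ.m≤n⇒m<n∨m≡n i≤m | ℕ.m≤n⇒m<n∨m≡n m≤j
    ... | inj₂ i≡m | _ = inj₁ (toℕ-injective i≡m)
    ... | inj₁ _ | inj₂ m≡j = inj₂ (inj₂ (toℕ-injective m≡j))
    ... | inj₁ i<m | inj₁ m<j = inj₂ (inj₁ (i<m , m<j))

    i≤j : i ≤ j
    i≤j = ℕ.<⇒≤ i<j

    some-low : ∃ Low
    some-low with any? (λ k → (i <? k ×-dec k <? j) ×-dec A k <? A i)
    ... | yes low = low
    ... | no ¬low = contradiction (Bi≤ j i≤j ≤-refl) (ℕ.<⇒≱ Bj<Bi)
      where
      Ai≤ : ∀ m → i ≤ m → m ≤ j → A i ≤ A m
      Ai≤ m i≤m m≤j with range-cases i≤m m≤j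
      ... | inj₁ refl = ≤-refl
      ... | inj₂ (inj₂ refl) = ℕ.<⇒≤ Ai<Aj
      ... | inj₂ (inj₁ between) with low-or-high between
      ...   | inj₁ Am<Ai = contradiction (m , between , Am<Ai) ¬low
      ...   | inj₂ Aj<Am = ℕ.<⇒≤ (<-trans Ai<Aj Aj<Am)
      Bi≤ : ∀ m → i ≤ m → m ≤ j → B i ≤ B m
      Bi≤ = proj₂ (proj₂ (argMin-transfer i≤j (≤-refl , i≤j , Ai≤)))

    some-high : ∃ High
    some-high with any? (λ k → (i <? k ×-dec k <? j) ×-dec A j <? A k)
    ... | yes high = high
    ... | no ¬high = contradiction (≤Bj i ≤-refl i≤j) (ℕ.<⇒≱ Bj<Bi)
      where
      ≤Aj : ∀ m → i ≤ m → m ≤ j → A m ≤ A j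
      ≤Aj m i≤m m≤j with range-cases i≤m m≤j
      ... | inj₁ refl = ℕ.<⇒≤ Ai<Aj
      ... | inj₂ (inj₂ refl) = ≤-refl
      ... | inj₂ (inj₁ between) with low-or-high between
      ...   | inj₁ Am<Ai = ℕ.<⇒≤ (<-trans Am<Ai Ai<Aj)
      ...   | inj₂ Aj<Am = contradiction (m , between , Aj<Am) ¬high
      ≤Bj : ∀ m → i ≤ m → m ≤ j → B m ≤ B j
      ≤Bj = proj₂ (proj₂ (argMax-transfer i≤j (i≤j , ≤-refl , ≤Aj)))

    ¬low⇒high : ∀ {k} → Between k → ¬ A k < A i → High k
    ¬low⇒high between ¬Ak<Ai with low-or-high between
    ... | inj₁ Ak<Ai = contradiction Ak<Ai ¬Ak<Ai
    ... | inj₂ Aj<Ak = between , Aj<Ak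

    ¬high⇒low : ∀ {k} → Between k → ¬ A j < A k → Low k
    ¬high⇒low between ¬Aj<Ak with low-or-high between
    ... | inj₁ Ak<Ai = between , Ak<Ai
    ... | inj₂ Aj<Ak = contradiction Aj<Ak ¬Aj<Ak

    between-crossing : {L : Fin n → Set} → Decidable L → ∀ {a b} → Between a → Between b →
                       a < b → L a → ¬ L b →
                       ∃₂ λ p p′ → toℕ p′ ≡ suc (toℕ p) × (Between p × L p) × (Between p′ × ¬ L p′)
    between-crossing L? (i<a , _) (_ , b<j) a<b La ¬Lb with fin-crossing L? a<b La ¬Lb
    ... | p , p′ , p′≡1+p , a≤p , p′≤b , Lp , ¬Lp′ =
      p , p′ , p′≡1+p , ((i<p , <-trans p<p′ p′<j) , Lp) , ((<-trans i<p p<p′ , p′<j) , ¬Lp′)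
      where
      p<p′ : p < p′
      p<p′ = subst (toℕ p ℕ.<_) (sym p′≡1+p) (ℕ.n<1+n (toℕ p))
      i<p : i < p
      i<p = ℕ.<-≤-trans i<a a≤p
      p′<j : p′ < j
      p′<j = ℕ.≤-<-trans p′≤b b<j

    ¬low-then-high : ∀ {p p′} → toℕ p′ ≡ suc (toℕ p) → Low p → High p′ → ⊥
    ¬low-then-high {p} {p′} p′≡1+p ((i<p , p<j) , Ap<Ai) ((i<p′ , p′<j) , Aj<Ap′) =
      σ-baxter i p p′ j i<p p′≡1+p p′<j
        (inj₂ (to-j i<p p<j (<-trans Ap<Ai Ai<Aj) , Bj<Bi , from-i i<p′ p′<j (<-trans Ai<Aj Aj<Ap′)))

    ¬high-then-low : ∀ {p p′} → toℕ p′ ≡ suc (toℕ p) → High p → Low p′ → ⊥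
    ¬high-then-low {p} {p′} p′≡1+p ((i<p , _) , Aj<Ap) ((_ , p′<j) , Ap′<Ai) =
      π-baxter i p p′ j i<p p′≡1+p p′<j (inj₁ (Ap′<Ai , Ai<Aj , Aj<Ap))

    ¬low-before-high : ∀ {m M} → m < M → Low m → High M → ⊥
    ¬low-before-high m<M (m-between , Am<Ai) (M-between , Aj<AM)
      with between-crossing (λ k → A k <? A i) m-between M-between m<M Am<Ai
             (<-asym (<-trans Ai<Aj Aj<AM))
    ... | p , p′ , p′≡1+p , low , (p′-between , ¬low) =
          ¬low-then-high p′≡1+p low (¬low⇒high p′-between ¬low)

    ¬high-before-low : ∀ {M m} → M < m → High M → Low m → ⊥
    ¬high-before-low M<m (M-between , Aj<AM) (m-between , Am<Ai)
      with between-crossing (λ k → A j <? A k) M-between m-between M<m Aj<AM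
             (<-asym (<-trans Am<Ai Ai<Aj))
    ... | p , p′ , p′≡1+p , high , (p′-between , ¬high) =
          ¬high-then-low p′≡1+p high (¬high⇒low p′-between ¬high)

    absurd : ⊥
    absurd with some-low | some-high
    ... | m , low | M , high with <-cmp m M
    ...   | tri< m<M _ _ = ¬low-before-high m<M low high
    ...   | tri≈ _ refl _ = <-asym (proj₂ low) (<-trans Ai<Aj (proj₂ high))
    ...   | tri> _ _ M<m = ¬high-before-low M<m high low

  AscentsPreservedWithin : ℕ → Set
  AscentsPreservedWithin d = ∀ {i j} → i < j → toℕ j ℕ.≤ d ℕ.+ toℕ i → A i < A j → B i < B j

  ascentsPreservedWithin : ∀ d → AscentsPreservedWithin d
  ascentsPreservedWithin zero i<j j≤i _ = contradiction j≤i (ℕ.<⇒≱ i<j)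
  ascentsPreservedWithin (suc d) {i} {j} i<j j≤1+d+i Ai<Aj with <-cmp (B i) (B j)
  ... | tri< Bi<Bj _ _ = Bi<Bj
  ... | tri≈ _ Bi≡Bj _ = contradiction (⟨$⟩ʳ-injective σ Bi≡Bj) (λ { refl → <-irrefl refl i<j })
  ... | tri> _ _ Bj<Bi = ⊥-elim (Inversion.absurd i<j Ai<Aj Bj<Bi from-i to-j)
    where
    shorter : AscentsPreservedWithin d
    shorter = ascentsPreservedWithin d
    from-i : ∀ {k} → i < k → k < j → A i < A k → B i < B k
    from-i i<k k<j = shorter i<k (ℕ.m<1+n⇒m≤n (ℕ.<-≤-trans k<j j≤1+d+i))
    to-j : ∀ {k} → i < k → k < j → A k < A j → B k < B j
    to-j {k} i<k k<j = shorter k<j (ℕ.≤-trans j≤1+d+i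
                         (subst (ℕ._≤ d ℕ.+ toℕ k) (ℕ.+-suc d (toℕ i)) (ℕ.+-monoʳ-≤ d i<k)))

  baxter⇒preservesAscents : PreservesAscents π σ
  baxter⇒preservesAscents {i} {j} i<j = ascentsPreservedWithin (toℕ j) i<j (ℕ.m≤m+n (toℕ j) (toℕ i))

lemma3 : (n : ℕ) (π σ : Permutation′ n) → IsBaxter π → IsBaxter σ →
    SameRMQAnswers π σ → (ℓ : Fin n) → π ⟨$⟩ʳ ℓ ≡ σ ⟨$⟩ʳ ℓ
lemma3 n π σ π-baxter σ-baxter same =
  sameAscents⇒≡ π σ (baxter⇒preservesAscents π σ π-baxter σ-baxter same)
                    (baxter⇒preservesAscents σ π σ-baxter π-baxter (SameRMQAnswers-sym π σ same))
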